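{- Let $G$ be a multi-flock chicken graph containing a non-eclipsed 2-Duke $d$. Then at least one of the following holds: (i) $G$ has a 1-Duke; (ii) $d$ is pecked by another 2-Duke; (iii) $G$ has at least three distinct 2-Dukes; (iv) $G$ has at least four distinct 3-Dukes.
   Context: A multi-flock chicken graph is a finite orientation of a complete multipartite graph; vertices are called chickens and partite sets are called flocks. "$c$ pecks $d$" means the edge between $c$ and $d$ is oriented from $c$ to $d$. A peck chain of length $m$ is a directed path with $m$ edges. A chicken $d$ is an $m$-Duke if every chicken not in the flock of $d$ can be reached from $d$ by a peck chain of length at most $m$. A chicken $e$ eclipses a chicken $d$ in the same flock if $e$ pecks every chicken that $d$ pecks and also pecks at least one chicken that $d$ does not peck; a chicken is non-eclipsed if no other chicken of its flock eclipses it. -}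

module Defs where

open import Data.Nat using (ℕ; zero; suc; _≤_)
open import Data.Fin using (Fin; zero; suc; fromℕ; inject₁)
open import Data.Bool using (Bool; true; false; not)
open import Data.Product using (Σ; ∃; ∃-syntax; _×_; _,_)
open import Relation.Binary.PropositionalEquality using (_≡_; _≢_)
open import Relation.Nullary using (¬_)
open import Function.Definitions using (Injective)

-- A multi-flock chicken graph: finitely many chickens (Fin n), each assigned a
-- flock label (chickens are in the same flock iff their labels are equal), and an
-- orientation of the complete multipartite graph on the flocks:
-- no pecking inside a flock, and between chickens of different flocks exactly
-- one of the two pecks the other.
record ChickenGraph : Set where
  field
    n     : ℕ
    flock : Fin n → ℕ
    peck  : Fin n → Fin n → Bool
    peck-same : ∀ c d → flock c ≡ flock d → peck c d ≡ false
    peck-diff : ∀ c d → flock c ≢ flock d → peck c d ≡ not (peck d c)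

module _ (G : ChickenGraph) where
  open ChickenGraph G

  Chicken : Set
  Chicken = Fin n

  Pecks : Chicken → Chicken → Set
  Pecks c d = peck c d ≡ true

  PeckChain : ℕ → Chicken → Chicken → Set
  PeckChain m c e =
    Σ (Fin (suc m) → Chicken) λ v →
      (v zero ≡ c) × (v (fromℕ m) ≡ e)
      × (∀ (i : Fin m) → Pecks (v (inject₁ i)) (v (suc i)))
      × Injective _≡_ _≡_ v

  Duke : ℕ → Chicken → Set
  Duke m d = ∀ c → flock c ≢ flock d → ∃[ l ] (l ≤ m × PeckChain l d c)

  Eclipses : Chicken → Chicken → Set
  Eclipses e d = flock e ≡ flock d
    × (∀ c → Pecks d c → Pecks e c)
    × ∃[ c ] (Pecks e c × ¬ Pecks d c)

  NonEclipsed : Chicken → Set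
  NonEclipsed d = ∀ e → flock e ≡ flock d → e ≢ d → ¬ Eclipses e d

module Submission where

-- A pecker c of d is a 3-Duke: a flock-mate t of d that c does not peck pecks c, which d
-- does not, so as t does not eclipse d there is a path d ⇀ x ⇀ t. Hence three peckers give
-- four 3-Dukes, and without peckers d is a 1-Duke. Otherwise d has one or two peckers, none
-- a 2-Duke, and a chicken y that a pecker c does not reach in two pecks pecks c and is a
-- flock-mate of d or the other pecker. A flock-mate of d reaching every pecker within three
-- pecks is a 3-Duke; this supplies the fourth 3-Duke when there are two peckers. With a
-- single pecker c the fourth is such a flock-mate other than y, or else a chicken pecking
-- both c and y, or else the middle x of a path d ⇀ x ⇀ y, which then lies in c's flock.

open import Defs
open import Data.Product using (Σ; ∃; ∃-syntax; _×_; _,_)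
open import Data.Sum using (_⊎_)
open import Relation.Binary.PropositionalEquality using (_≡_; _≢_)

open import Data.Bool using (true; not)
open import Data.Bool.Properties using (¬-not) renaming (_≟_ to _≟ᵇ_)
open import Data.Empty using (⊥-elim)
open import Data.Fin using (Fin; zero; suc; inject₁)
open import Data.Fin.Properties using (any?) renaming (_≟_ to _≟ᶠ_)
open import Data.Nat using (ℕ; suc; _≤_; _+_; z≤n; s≤s)
open import Data.Nat.Properties using (≤-trans; n≤1+n) renaming (_≟_ to _≟ⁿ_)
open import Data.Product using (proj₁; proj₂)
open import Data.Sum using (inj₁; inj₂)
open import Data.Vec.Functional using (_∷_)
open import Function using (_∘_)
open import Function.Definitions using (Injective)
open import Level using (Level)
open import Relation.Nullary using (¬_; Dec; yes; no; ¬?; _×-dec_; _⊎-dec_)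
open import Relation.Nullary.Decidable using (decidable-stable)
open import Relation.Unary using (Pred; _⊆_) renaming (Decidable to Decidable₁)
open import Relation.Binary.PropositionalEquality using (refl; sym; trans; cong; ≢-sym)

⊆⊎∃-outside : ∀ {n} {p q : Level} {P : Pred (Fin n) p} {Q : Pred (Fin n) q} →
  Decidable₁ P → Decidable₁ Q → P ⊆ Q ⊎ ∃[ i ] (P i × ¬ Q i)
⊆⊎∃-outside P? Q? with any? (λ i → P? i ×-dec ¬? (Q? i))
... | yes outside = inj₂ outside
... | no  none    = inj₁ λ {i} p → decidable-stable (Q? i) λ ¬q → none (i , p , ¬q)

module _ (G : ChickenGraph) where
  open ChickenGraph G

  private variable
    m m′ : ℕ
    a b c d e r t x y c₁ c₂ y₁ y₂ : Chicken G

  infix 4 _⇀_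
  _⇀_ : Chicken G → Chicken G → Set
  a ⇀ b = Pecks G a b

  pecks? : ∀ a b → Dec (a ⇀ b)
  pecks? a b = peck a b ≟ᵇ true

  flock? : ∀ a b → Dec (flock a ≡ flock b)
  flock? a b = flock a ≟ⁿ flock b

  flock≢⇒≢ : flock a ≢ flock b → a ≢ b
  flock≢⇒≢ a≁b refl = a≁b refl

  ⇀⇒flock≢ : a ⇀ b → flock a ≢ flock b
  ⇀⇒flock≢ {a} {b} a⇀b a∼b with () ← trans (sym a⇀b) (peck-same a b a∼b)

  ⇀⇒≢ : a ⇀ b → a ≢ b
  ⇀⇒≢ a⇀b = flock≢⇒≢ (⇀⇒flock≢ a⇀b)

  ⇀-asym : a ⇀ b → ¬ b ⇀ a
  ⇀-asym {a} {b} a⇀b b⇀a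
    with () ← trans (sym a⇀b) (trans (peck-diff a b (⇀⇒flock≢ a⇀b)) (cong not b⇀a))

  ⇀⇀⇒≢ : a ⇀ b → b ⇀ c → a ≢ c
  ⇀⇀⇒≢ a⇀b b⇀a refl = ⇀-asym a⇀b b⇀a

  ¬⇀⇒⇀ : flock a ≢ flock b → ¬ a ⇀ b → b ⇀ a
  ¬⇀⇒⇀ {a} {b} a≁b ¬a⇀b = trans (peck-diff b a (≢-sym a≁b)) (cong not (¬-not ¬a⇀b))

  flockmate≁pecker : flock e ≡ flock d → c ⇀ d → flock e ≢ flock c
  flockmate≁pecker e∼d c⇀d e∼c = ⇀⇒flock≢ c⇀d (trans (sym e∼c) e∼d)

  chain₀ : PeckChain G 0 a a
  chain₀ {a} = (λ _ → a) , refl , refl , (λ ()) , λ { {zero} {zero} _ → refl }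

  chain-∷ : a ⇀ b → (ch : PeckChain G m b e) → (∀ i → proj₁ ch i ≢ a) →
    PeckChain G (suc m) a e
  chain-∷ {a} a⇀b (v , refl , v-end , steps , v-inj) a∉v = a ∷ v , refl , v-end , steps′ , inj
    where
    steps′ : ∀ i → (a ∷ v) (inject₁ i) ⇀ (a ∷ v) (suc i)
    steps′ zero    = a⇀b
    steps′ (suc i) = steps i

    inj : Injective _≡_ _≡_ (a ∷ v)
    inj {zero}  {zero}  _     = refl
    inj {zero}  {suc j} a≡vj  = ⊥-elim (a∉v j (sym a≡vj))
    inj {suc i} {zero}  vi≡a  = ⊥-elim (a∉v i vi≡a)
    inj {suc i} {suc j} vi≡vj = cong suc (v-inj vi≡vj)

  chain₁ : a ⇀ b → PeckChain G 1 a b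
  chain₁ a⇀b = chain-∷ a⇀b chain₀ λ { zero → ≢-sym (⇀⇒≢ a⇀b) }

  chain₂ : a ⇀ b → b ⇀ c → PeckChain G 2 a c
  chain₂ a⇀b b⇀c = chain-∷ a⇀b (chain₁ b⇀c) λ
    { zero       → ≢-sym (⇀⇒≢ a⇀b)
    ; (suc zero) → ≢-sym (⇀⇀⇒≢ a⇀b b⇀c) }

  chain₃ : a ⇀ b → b ⇀ c → c ⇀ e → a ≢ e → PeckChain G 3 a e
  chain₃ a⇀b b⇀c c⇀e a≢e = chain-∷ a⇀b (chain₂ b⇀c c⇀e) λ
    { zero             → ≢-sym (⇀⇒≢ a⇀b)
    ; (suc zero)       → ≢-sym (⇀⇀⇒≢ a⇀b b⇀c)
    ; (suc (suc zero)) → ≢-sym a≢e }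

  Reaches : ℕ → Chicken G → Chicken G → Set
  Reaches m a b = ∃[ l ] (l ≤ m × PeckChain G l a b)

  reaches₁ : a ⇀ b → Reaches (1 + m) a b
  reaches₁ a⇀b = 1 , s≤s z≤n , chain₁ a⇀b

  reaches₂ : a ⇀ b → b ⇀ c → Reaches (2 + m) a c
  reaches₂ a⇀b b⇀c = 2 , s≤s (s≤s z≤n) , chain₂ a⇀b b⇀c

  reaches₃ : a ⇀ b → b ⇀ c → c ⇀ e → a ≢ e → Reaches (3 + m) a e
  reaches₃ a⇀b b⇀c c⇀e a≢e = 3 , s≤s (s≤s (s≤s z≤n)) , chain₃ a⇀b b⇀c c⇀e a≢e

  duke-mono : m ≤ m′ → Duke G m d → Duke G m′ d
  duke-mono m≤m′ duke t t≁d with duke t t≁d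
  ... | l , l≤m , chain = l , ≤-trans l≤m m≤m′ , chain

  Within₂ : Chicken G → Chicken G → Set
  Within₂ a b = a ⇀ b ⊎ ∃[ x ] (a ⇀ x × x ⇀ b)

  within₂? : ∀ a b → Dec (Within₂ a b)
  within₂? a b = pecks? a b ⊎-dec any? (λ x → pecks? a x ×-dec pecks? x b)

  within₂⇒reaches : Within₂ a b → Reaches (2 + m) a b
  within₂⇒reaches (inj₁ a⇀b)             = reaches₁ a⇀b
  within₂⇒reaches (inj₂ (_ , a⇀x , x⇀b)) = reaches₂ a⇀x x⇀b

  ⇀-within₂⇒reaches₃ : a ⇀ b → Within₂ b c → a ≢ c → Reaches 3 a c
  ⇀-within₂⇒reaches₃ a⇀b (inj₁ b⇀c)             _   = reaches₂ a⇀b b⇀c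
  ⇀-within₂⇒reaches₃ a⇀b (inj₂ (_ , b⇀x , x⇀c)) a≢c = reaches₃ a⇀b b⇀x x⇀c a≢c

  duke₂⇒within₂ : Duke G 2 d → flock t ≢ flock d → Within₂ d t
  duke₂⇒within₂ {t = t} duke t≁d with duke t t≁d
  ... | 0 , _ , _ , refl , refl , _           = ⊥-elim (t≁d refl)
  ... | 1 , _ , _ , refl , refl , step , _    = inj₁ (step zero)
  ... | 2 , _ , v , refl , refl , step , _    = inj₂ (v (suc zero) , step zero , step (suc zero))
  ... | suc (suc (suc _)) , s≤s (s≤s ()) , _

  duke₁⊎pecked : ∀ d → Duke G 1 d ⊎ ∃[ c ] c ⇀ d
  duke₁⊎pecked d with ⊆⊎∃-outside (λ t → ¬? (flock? t d)) (pecks? d)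
  ... | inj₁ pecks-all              = inj₁ λ _ t≁d → reaches₁ (pecks-all t≁d)
  ... | inj₂ (c , c≁d , ¬d⇀c) = inj₂ (c , ¬⇀⇒⇀ (≢-sym c≁d) ¬d⇀c)

  Unreached₂ : Chicken G → Chicken G → Set
  Unreached₂ c y = flock y ≢ flock c × ¬ Within₂ c y

  PeckedByDuke₂ : Chicken G → Set
  PeckedByDuke₂ d = ∃[ c ] (c ≢ d × Duke G 2 c × c ⇀ d)

  pecker-duke₂⊎unreached : c ⇀ d → PeckedByDuke₂ d ⊎ ∃[ y ] Unreached₂ c y
  pecker-duke₂⊎unreached {c} c⇀d with ⊆⊎∃-outside (λ t → ¬? (flock? t c)) (within₂? c)
  ... | inj₁ within = inj₁ (c , ⇀⇒≢ c⇀d , (λ _ t≁c → within₂⇒reaches (within t≁c)) , c⇀d)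
  ... | inj₂ unreached = inj₂ unreached

  unreached₂⇒⇀ : Unreached₂ c y → y ⇀ c
  unreached₂⇒⇀ (y≁c , ¬within) = ¬⇀⇒⇀ (≢-sym y≁c) λ c⇀y → ¬within (inj₁ c⇀y)

  ⇀-unreached₂⇒⇀ : Unreached₂ c y → r ⇀ y → flock r ≢ flock c → r ⇀ c
  ⇀-unreached₂⇒⇀ (_ , ¬within) r⇀y r≁c = ¬⇀⇒⇀ (≢-sym r≁c) λ c⇀r → ¬within (inj₂ (_ , c⇀r , r⇀y))

  unreached₂-from-pecker : c ⇀ d → Unreached₂ c y → flock y ≡ flock d ⊎ y ⇀ d
  unreached₂-from-pecker {d = d} {y = y} c⇀d (_ , ¬within) with flock? y d | pecks? d y
  ... | yes y∼d | _        = inj₁ y∼d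
  ... | no y≁d  | yes d⇀y = ⊥-elim (¬within (inj₂ (d , c⇀d , d⇀y)))
  ... | no y≁d  | no ¬d⇀y = inj₂ (¬⇀⇒⇀ (≢-sym y≁d) ¬d⇀y)

  nonEclipsed⇒⇀⇀flockmate : NonEclipsed G d → flock t ≡ flock d → t ≢ d → t ⇀ c → ¬ d ⇀ c →
    ∃[ x ] (d ⇀ x × x ⇀ t)
  nonEclipsed⇒⇀⇀flockmate {d} {t} d-ne t∼d t≢d t⇀c ¬d⇀c with ⊆⊎∃-outside (pecks? d) (pecks? t)
  ... | inj₁ t-covers = ⊥-elim (d-ne t t∼d t≢d (t∼d , (λ _ → t-covers) , _ , t⇀c , ¬d⇀c))
  ... | inj₂ (x , d⇀x , ¬t⇀x) = x , d⇀x , ¬⇀⇒⇀ (λ t∼x → ⇀⇒flock≢ d⇀x (trans (sym t∼d) t∼x)) ¬t⇀x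

  pecker⇒duke₃ : Duke G 2 d → NonEclipsed G d → c ⇀ d → Duke G 3 c
  pecker⇒duke₃ {d} {c} d-duke d-ne c⇀d t t≁c with flock? t d
  ... | no t≁d = ⇀-within₂⇒reaches₃ c⇀d (duke₂⇒within₂ d-duke t≁d) (flock≢⇒≢ (≢-sym t≁c))
  ... | yes t∼d with t ≟ᶠ d | pecks? c t
  ...   | yes refl | _        = reaches₁ c⇀d
  ...   | no _     | yes c⇀t = reaches₁ c⇀t
  ...   | no t≢d   | no ¬c⇀t = ⇀-within₂⇒reaches₃ c⇀d (inj₂ d⇀⇀t) (flock≢⇒≢ (≢-sym t≁c))
    where
    d⇀⇀t = nonEclipsed⇒⇀⇀flockmate d-ne t∼d t≢d (¬⇀⇒⇀ (≢-sym t≁c) ¬c⇀t) (⇀-asym c⇀d)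

  flockmate-reaching-peckers⇒duke₃ : flock e ≡ flock d → e ⇀ c → c ⇀ d →
    (∀ {v} → v ⇀ d → Reaches 3 e v) → Duke G 3 e
  flockmate-reaching-peckers⇒duke₃ {e} {d} e∼d e⇀c c⇀d reaches-peckers t t≁e with pecks? d t
  ... | yes d⇀t = ⇀-within₂⇒reaches₃ e⇀c (inj₂ (d , c⇀d , d⇀t)) (flock≢⇒≢ (≢-sym t≁e))
  ... | no ¬d⇀t = reaches-peckers (¬⇀⇒⇀ (λ d∼t → t≁e (trans (sym d∼t) (sym e∼d))) ¬d⇀t)

  AnotherDuke₃ : Chicken G → Chicken G → Chicken G → Set
  AnotherDuke₃ a b c = ∃[ f ] (f ≢ a × f ≢ b × f ≢ c × Duke G 3 f)

  FourDistinctDukes₃ : Set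
  FourDistinctDukes₃ = ∃[ a ] ∃[ b ] ∃[ c ] ∃[ e ] (a ≢ b × a ≢ c × a ≢ e × b ≢ c × b ≢ e × c ≢ e
    × Duke G 3 a × Duke G 3 b × Duke G 3 c × Duke G 3 e)

  fourDukes₃ : a ≢ b → Duke G 3 a → Duke G 3 b → a ≢ c → b ≢ c → Duke G 3 c → AnotherDuke₃ a b c →
    FourDistinctDukes₃
  fourDukes₃ a≢b a-duke b-duke a≢c b≢c c-duke (f , f≢a , f≢b , f≢c , f-duke) =
    _ , _ , _ , f , a≢b , a≢c , ≢-sym f≢a , b≢c , ≢-sym f≢b , ≢-sym f≢c , a-duke , b-duke , c-duke , f-duke

  duke₂-pecker⇒fourDukes₃ : Duke G 2 d → NonEclipsed G d → c ⇀ d → d ≢ b → c ≢ b → Duke G 3 b →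
    AnotherDuke₃ d c b → FourDistinctDukes₃
  duke₂-pecker⇒fourDukes₃ d-duke d-ne c⇀d =
    fourDukes₃ (≢-sym (⇀⇒≢ c⇀d)) (duke-mono (n≤1+n 2) d-duke) (pecker⇒duke₃ d-duke d-ne c⇀d)

  pecker⇒anotherDuke₃ : Duke G 2 d → NonEclipsed G d → c ⇀ d → c ≢ c₁ → c ≢ c₂ → AnotherDuke₃ d c₁ c₂
  pecker⇒anotherDuke₃ d-duke d-ne c⇀d c≢c₁ c≢c₂ = _ , ⇀⇒≢ c⇀d , c≢c₁ , c≢c₂ , pecker⇒duke₃ d-duke d-ne c⇀d

  module _ {d c y : Chicken G} (c⇀d : c ⇀ d) (sole : (_⇀ d) ⊆ (_≡ c)) (y-far : Unreached₂ c y) where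

    private
      y⇀c : y ⇀ c
      y⇀c = unreached₂⇒⇀ y-far

      y≢d : y ≢ d
      y≢d refl = proj₂ y-far (inj₁ c⇀d)

      y∼d : flock y ≡ flock d
      y∼d with unreached₂-from-pecker c⇀d y-far
      ... | inj₁ y∼d = y∼d
      ... | inj₂ y⇀d = ⊥-elim (⇀⇒≢ y⇀c (sole y⇀d))

      reaching-c⇒reaching-peckers : Reaches 3 e c → ∀ {v} → v ⇀ d → Reaches 3 e v
      reaching-c⇒reaching-peckers e↝c v⇀d with sole v⇀d
      ... | refl = e↝c

    module _ (c-covers : (λ t → flock t ≡ flock d × t ≢ y) ⊆ (c ⇀_)) where

      sole-pecker-within₂ : t ≢ c → t ≢ y → Within₂ c t
      sole-pecker-within₂ {t} t≢c t≢y with flock? t d | pecks? d t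
      ... | yes t∼d | _        = inj₁ (c-covers (t∼d , t≢y))
      ... | no _    | yes d⇀t = inj₂ (d , c⇀d , d⇀t)
      ... | no t≁d  | no ¬d⇀t = ⊥-elim (t≢c (sole (¬⇀⇒⇀ (≢-sym t≁d) ¬d⇀t)))

      pecks-c-and-y⇒duke₃ : r ⇀ c → r ⇀ y → Duke G 3 r
      pecks-c-and-y⇒duke₃ r⇀c r⇀y t t≁r with t ≟ᶠ y | t ≟ᶠ c
      ... | yes refl | _        = reaches₁ r⇀y
      ... | no _     | yes refl = reaches₁ r⇀c
      ... | no t≢y   | no t≢c   =
        ⇀-within₂⇒reaches₃ r⇀c (sole-pecker-within₂ t≢c t≢y) (flock≢⇒≢ (≢-sym t≁r))

      -- Outside d's flock, y must peck t: otherwise t pecks y and, as c does not reach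
      -- y in two, also c.
      in-flock-of-c-pecking-y⇒duke₃ : ¬ (∃[ r ] (r ⇀ y × r ⇀ c)) → flock x ≡ flock c → x ⇀ y → Duke G 3 x
      in-flock-of-c-pecking-y⇒duke₃ no-r x∼c x⇀y t t≁x with t ≟ᶠ y
      ... | yes refl = reaches₁ x⇀y
      ... | no t≢y with flock? t d | pecks? y t
      ...   | yes t∼d | _        = reaches₃ x⇀y y⇀c (c-covers (t∼d , t≢y)) (flock≢⇒≢ (≢-sym t≁x))
      ...   | no _    | yes y⇀t = reaches₂ x⇀y y⇀t
      ...   | no t≁d  | no ¬y⇀t = ⊥-elim (no-r (t , t⇀y , ⇀-unreached₂⇒⇀ y-far t⇀y t≁c))
        where
        t⇀y = ¬⇀⇒⇀ (λ y∼t → t≁d (trans (sym y∼t) y∼d)) ¬y⇀t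
        t≁c = λ t∼c → t≁x (trans t∼c (sym x∼c))

    sole-pecker-fourth : NonEclipsed G d → AnotherDuke₃ d c y
    sole-pecker-fourth d-ne with ⊆⊎∃-outside (λ t → flock? t d ×-dec ¬? (t ≟ᶠ y)) (pecks? c)
    ... | inj₂ (e , (e∼d , e≢y) , ¬c⇀e) =
      e , ⇀⇀⇒≢ e⇀c c⇀d , flock≢⇒≢ e≁c , e≢y ,
      flockmate-reaching-peckers⇒duke₃ e∼d e⇀c c⇀d (reaching-c⇒reaching-peckers (reaches₁ e⇀c))
      where
      e≁c = flockmate≁pecker e∼d c⇀d
      e⇀c = ¬⇀⇒⇀ (≢-sym e≁c) ¬c⇀e
    ... | inj₁ c-covers with any? (λ r → pecks? r y ×-dec pecks? r c)
    ...   | yes (r , r⇀y , r⇀c) =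
      r , ⇀⇀⇒≢ r⇀c c⇀d , ⇀⇒≢ r⇀c , ⇀⇒≢ r⇀y , pecks-c-and-y⇒duke₃ c-covers r⇀c r⇀y
    ...   | no no-r with nonEclipsed⇒⇀⇀flockmate d-ne y∼d y≢d y⇀c (⇀-asym c⇀d)
    ...     | x , d⇀x , x⇀y =
      x , ≢-sym (⇀⇒≢ d⇀x) , ≢-sym (⇀⇀⇒≢ c⇀d d⇀x) , ⇀⇒≢ x⇀y ,
      in-flock-of-c-pecking-y⇒duke₃ c-covers no-r x∼c x⇀y
      where
      x∼c : flock x ≡ flock c
      x∼c with flock? x c
      ... | yes x∼c = x∼c
      ... | no x≁c  = ⊥-elim (no-r (x , x⇀y , ⇀-unreached₂⇒⇀ y-far x⇀y x≁c))

    sole-pecker⇒fourDukes₃ : Duke G 2 d → NonEclipsed G d → FourDistinctDukes₃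
    sole-pecker⇒fourDukes₃ d-duke d-ne = duke₂-pecker⇒fourDukes₃ d-duke d-ne c⇀d
      (≢-sym y≢d) (flock≢⇒≢ (≢-sym (proj₁ y-far)))
      (flockmate-reaching-peckers⇒duke₃ y∼d y⇀c c⇀d (reaching-c⇒reaching-peckers (reaches₁ y⇀c)))
      (sole-pecker-fourth d-ne)

  module _ {d c₁ c₂ : Chicken G} (peckers : (_⇀ d) ⊆ (λ v → v ≡ c₁ ⊎ v ≡ c₂))
           (c₁⇀d : c₁ ⇀ d) (c₂⇀d : c₂ ⇀ d) where

    private
      flockmate-fourth : flock e ≡ flock d → e ⇀ c → c ⇀ d → Reaches 3 e c₁ → Reaches 3 e c₂ →
        AnotherDuke₃ d c₁ c₂
      flockmate-fourth {e} e∼d e⇀c c⇀d e↝c₁ e↝c₂ =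
        e , ⇀⇀⇒≢ e⇀c c⇀d , flock≢⇒≢ (flockmate≁pecker e∼d c₁⇀d) , flock≢⇒≢ (flockmate≁pecker e∼d c₂⇀d) ,
        flockmate-reaching-peckers⇒duke₃ e∼d e⇀c c⇀d reaching-peckers
        where
        reaching-peckers : ∀ {v} → v ⇀ d → Reaches 3 e v
        reaching-peckers v⇀d with peckers v⇀d
        ... | inj₁ refl = e↝c₁
        ... | inj₂ refl = e↝c₂

      fourth : y₁ ⇀ c₁ → flock y₁ ≡ flock d ⊎ y₁ ⇀ d → y₂ ⇀ c₂ → flock y₂ ≡ flock d ⊎ y₂ ⇀ d →
        AnotherDuke₃ d c₁ c₂
      fourth {y₂ = y₂} y₁⇀c₁ (inj₁ y₁∼d) y₂⇀c₂ (inj₁ y₂∼d) with pecks? y₂ c₁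
      ... | yes y₂⇀c₁ = flockmate-fourth y₂∼d y₂⇀c₂ c₂⇀d (reaches₁ y₂⇀c₁) (reaches₁ y₂⇀c₂)
      ... | no ¬y₂⇀c₁ = flockmate-fourth y₁∼d y₁⇀c₁ c₁⇀d (reaches₁ y₁⇀c₁)
        (reaches₃ y₁⇀c₁ (¬⇀⇒⇀ (flockmate≁pecker y₂∼d c₁⇀d) ¬y₂⇀c₁) y₂⇀c₂ (flock≢⇒≢ (flockmate≁pecker y₁∼d c₂⇀d)))
      fourth y₁⇀c₁ (inj₁ y₁∼d) y₂⇀c₂ (inj₂ y₂⇀d) with peckers y₂⇀d
      ... | inj₁ refl = flockmate-fourth y₁∼d y₁⇀c₁ c₁⇀d (reaches₁ y₁⇀c₁) (reaches₂ y₁⇀c₁ y₂⇀c₂)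
      ... | inj₂ refl = ⊥-elim (⇀⇒≢ y₂⇀c₂ refl)
      fourth y₁⇀c₁ (inj₂ y₁⇀d) y₂⇀c₂ y₂-place with peckers y₁⇀d | y₂-place
      ... | inj₁ refl | _           = ⊥-elim (⇀⇒≢ y₁⇀c₁ refl)
      ... | inj₂ refl | inj₁ y₂∼d  = flockmate-fourth y₂∼d y₂⇀c₂ c₂⇀d (reaches₂ y₂⇀c₂ y₁⇀c₁) (reaches₁ y₂⇀c₂)
      ... | inj₂ refl | inj₂ y₂⇀d with peckers y₂⇀d
      ...   | inj₁ refl = ⊥-elim (⇀-asym y₁⇀c₁ y₂⇀c₂)
      ...   | inj₂ refl = ⊥-elim (⇀⇒≢ y₂⇀c₂ refl)

    two-peckers-fourth : Unreached₂ c₁ y₁ → Unreached₂ c₂ y₂ → AnotherDuke₃ d c₁ c₂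
    two-peckers-fourth y₁-far y₂-far =
      fourth (unreached₂⇒⇀ y₁-far) (unreached₂-from-pecker c₁⇀d y₁-far)
             (unreached₂⇒⇀ y₂-far) (unreached₂-from-pecker c₂⇀d y₂-far)

lemma4 : (G : ChickenGraph) (d : Chicken G) → Duke G 2 d → NonEclipsed G d →
    (∃[ c ] Duke G 1 c)
    ⊎ (∃[ c ] (c ≢ d × Duke G 2 c × Pecks G c d))
    ⊎ (∃[ a ] ∃[ b ] ∃[ c ] (a ≢ b × a ≢ c × b ≢ c
        × Duke G 2 a × Duke G 2 b × Duke G 2 c))
    ⊎ (∃[ a ] ∃[ b ] ∃[ c ] ∃[ e ] (a ≢ b × a ≢ c × a ≢ e × b ≢ c × b ≢ e × c ≢ e
        × Duke G 3 a × Duke G 3 b × Duke G 3 c × Duke G 3 e))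
lemma4 G d d-duke d-ne with duke₁⊎pecked G d
... | inj₁ d-duke₁ = inj₁ (d , d-duke₁)
... | inj₂ (c₁ , c₁⇀d) with pecker-duke₂⊎unreached G c₁⇀d
...   | inj₁ pecked = inj₂ (inj₁ pecked)
...   | inj₂ (y₁ , y₁-far) with ⊆⊎∃-outside (λ v → pecks? G v d) (_≟ᶠ c₁)
...     | inj₁ sole = inj₂ (inj₂ (inj₂ (sole-pecker⇒fourDukes₃ G c₁⇀d sole y₁-far d-duke d-ne)))
...     | inj₂ (c₂ , c₂⇀d , c₂≢c₁) with pecker-duke₂⊎unreached G c₂⇀d
...       | inj₁ pecked = inj₂ (inj₁ pecked)
...       | inj₂ (y₂ , y₂-far) = inj₂ (inj₂ (inj₂ (duke₂-pecker⇒fourDukes₃ G d-duke d-ne c₁⇀d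
            (≢-sym (⇀⇒≢ G c₂⇀d)) (≢-sym c₂≢c₁) (pecker⇒duke₃ G d-duke d-ne c₂⇀d) fourth)))
  where
  fourth : AnotherDuke₃ G d c₁ c₂
  fourth with ⊆⊎∃-outside (λ v → pecks? G v d) (λ v → (v ≟ᶠ c₁) ⊎-dec (v ≟ᶠ c₂))
  ... | inj₁ two-peckers = two-peckers-fourth G two-peckers c₁⇀d c₂⇀d y₁-far y₂-far
  ... | inj₂ (c₃ , c₃⇀d , c₃∉) = pecker⇒anotherDuke₃ G d-duke d-ne c₃⇀d (c₃∉ ∘ inj₁) (c₃∉ ∘ inj₂)
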